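{- Let $K(x)=\sum_{n\le x}\phi(n)$. For all real $x\ge1$, $$K(C_1x)\ge\tfrac14K(x)-2,\qquad K(C_2x)\ge\tfrac12K(x)-2,\qquad K(C_3x)\ge\tfrac34K(x)-2,$$ where $C_1=0.539$, $C_2=0.742$, $C_3=0.917$.
   Context: The sum ranges over positive integers $n$; $\phi$ is Euler's totient function.
   Formalization: The variable $x$ ranges over the rationals with $x\ge1$ instead of over all real $x\ge1$. -}

module Defs where

open import Data.Nat using (ℕ; zero; suc; _+_)
open import Data.Nat.GCD using (gcd)
open import Data.Nat.Properties using (_≟_)
open import Data.Integer using (∣_∣)
open import Relation.Nullary.Decidable using (does)
open import Data.Bool using (if_then_else_)
open import Data.Rational using (ℚ; floor)

-- Euler's totient: φ n = #{ k | 1 ≤ k ≤ n, gcd k n = 1 }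
-- (gives φ 1 = 1 and φ 0 = 0, the latter never used).
coprimeCount : ℕ → ℕ → ℕ
coprimeCount n zero    = 0
coprimeCount n (suc k) =
  (if does (gcd (suc k) n ≟ 1) then 1 else 0) + coprimeCount n k

φ : ℕ → ℕ
φ n = coprimeCount n n

sumφ : ℕ → ℕ
sumφ zero    = 0
sumφ (suc N) = φ (suc N) + sumφ N

-- K x = Σ_{n ≤ x} φ n = Σ_{1 ≤ n ≤ ⌊x⌋} φ n  (used only for x ≥ 0)
K : ℚ → ℕ
K x = sumφ ∣ floor x ∣

{-# OPTIONS --safe #-}
-- Write S N = sumφ N, the number of pairs 1 ≤ k ≤ n ≤ N with gcd k n = 1, so that K x = S ⌊x⌋.
-- The pairs with d ∣ k and d ∣ n number A_d(N) = t(t+1)/2 for t = ⌊N/d⌋, i.e. N²/(2d²) ± N/(2d).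
-- Sieving by 2, 3, 5 and 7 (Möbius inversion over the divisors of 210) gives S N ≤ Σ_{d ∣ 210} μ(d) A_d(N).
-- Conversely, a pair whose gcd g is prime to 210 but not 1 has 1 < g ≤ 400, or g > 400, and
-- Σ_{g > 400} A_g(N) ≤ N²/400 by telescoping; hence S N ≥ Σ μ(d) A_d(N) − Σ_{1<q≤400, (q,210)=1} A_q(N) − N²/400.
-- With 1/d² rounded to multiples of 10⁻¹² this gives 0.2956 N² − O(N) ≤ S N ≤ 0.3135 N² + O(N),
-- and for m = ⌊c N / 1000⌋ then a ⋅ S N ≤ 4 ⋅ S m as soon as N ≥ 460; smaller N are checked by
-- tabulating S. Finally K (c x / 1000) ≥ S m for N = ⌊x⌋, since S is monotone.

module Submission where

open import Defs

module _ where
  open import Data.Bool using (Bool; T; _∧_; if_then_else_)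
  open import Data.Bool.ListAction using (all)
  open import Data.Bool.Properties using (T-∧)
  open import Data.List using (List; []; _∷_; map; filter; applyDownFrom; downFrom)
  open import Data.List.Membership.Propositional using (_∈_)
  open import Data.List.Membership.Propositional.Properties
    using (∈-applyDownFrom⁺; ∈-applyDownFrom⁻; ∈-downFrom⁺; ∈-filter⁺)
  open import Data.List.Properties using (filter-none; filter-accept)
  open import Data.List.Relation.Unary.All as All using (All; lookup; all?)
  open import Data.List.Relation.Unary.All.Properties using (all⁺)
  open import Data.List.Relation.Unary.Any using (here; there)
  open import Data.Nat
  open import Data.Nat.DivMod using (m/n*n≤m; m≡m%n+[m/n]*n; m%n<n; m*n/n≡m; /-monoˡ-≤)
  open import Data.Nat.Divisibility using (_∣_; _∣?_; divides; ∣-trans; ∣⇒≤)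
  open import Data.Nat.GCD using (gcd; gcd[m,n]≤n; gcd[m,n]∣m; gcd[m,n]∣n; gcd-greatest; gcd[m,n]≢0)
  open import Data.Nat.ListAction using (sum)
  open import Data.Nat.Properties
  open import Algebra.Properties.CommutativeSemigroup +-commutativeSemigroup using (interchange; x∙yz≈yx∙z)
  open import Data.Nat.Tactic.RingSolver using (solve-∀)
  open import Data.Product as Product using (_×_; _,_; proj₁; proj₂)
  open import Data.Sum using (inj₁)
  open import Function using (_∘_)
  open import Function.Bundles using (Equivalence)
  open import Relation.Binary.PropositionalEquality
  open import Relation.Nullary using (Dec; yes; no; does; ¬_; contradiction)
  open import Relation.Nullary.Decidable using (toWitness; _×-dec_; _→-dec_)

  ⟦_⟧ : {P : Set} → Dec P → ℕ
  ⟦ P? ⟧ = if does P? then 1 else 0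

  ∑ : List ℕ → (ℕ → ℕ) → ℕ
  ∑ xs f = sum (map f xs)

  infix 5 ∑
  syntax ∑ xs (λ x → e) = ∑[ x ∈ xs ] e

  -- [n, n ∸ 1, …, 1], listed downwards so that it unfolds like sumφ.
  [1⋯_] : ℕ → List ℕ
  [1⋯ n ] = applyDownFrom suc n

  pairSum : (ℕ → ℕ → ℕ) → ℕ → ℕ
  pairSum f N = ∑[ n ∈ [1⋯ N ] ] ∑[ k ∈ [1⋯ n ] ] f k n

  ⟦⟧-yes : ∀ {P} (P? : Dec P) → P → ⟦ P? ⟧ ≡ 1
  ⟦⟧-yes (yes _) _ = refl
  ⟦⟧-yes (no ¬p) p = contradiction p ¬p

  ⟦⟧-no : ∀ {P} (P? : Dec P) → ¬ P → ⟦ P? ⟧ ≡ 0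
  ⟦⟧-no (yes p) ¬p = contradiction p ¬p
  ⟦⟧-no (no _)  _  = refl

  ⟦⟧-mono-≤ : ∀ {P Q} (P? : Dec P) (Q? : Dec Q) → (P → Q) → ⟦ P? ⟧ ≤ ⟦ Q? ⟧
  ⟦⟧-mono-≤ (yes p) Q? P→Q = ≤-reflexive (sym (⟦⟧-yes Q? (P→Q p)))
  ⟦⟧-mono-≤ (no _)  Q? P→Q = z≤n

  ⟦⟧-≤1 : ∀ {P} (P? : Dec P) → ⟦ P? ⟧ ≤ 1
  ⟦⟧-≤1 (yes _) = ≤-refl
  ⟦⟧-≤1 (no _)  = z≤n

  ⟦⟧-* : ∀ {P Q R} (P? : Dec P) (Q? : Dec Q) (R? : Dec R) → (R → P × Q) → (P → Q → R) →
         ⟦ P? ⟧ * ⟦ Q? ⟧ ≡ ⟦ R? ⟧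
  ⟦⟧-* (yes p) (yes q) R? _   pqr = sym (⟦⟧-yes R? (pqr p q))
  ⟦⟧-* (yes _) (no ¬q) R? rpq _   = sym (⟦⟧-no R? λ r → ¬q (proj₂ (rpq r)))
  ⟦⟧-* (no ¬p) Q?      R? rpq _   = sym (⟦⟧-no R? λ r → ¬p (proj₁ (rpq r)))

  ∑-cong : ∀ xs {f g : ℕ → ℕ} → (∀ {x} → x ∈ xs → f x ≡ g x) → ∑ xs f ≡ ∑ xs g
  ∑-cong []       f≗g = refl
  ∑-cong (x ∷ xs) f≗g = cong₂ _+_ (f≗g (here refl)) (∑-cong xs (f≗g ∘ there))

  ∑-zero : ∀ xs → ∑[ x ∈ xs ] 0 ≡ 0
  ∑-zero []       = refl
  ∑-zero (_ ∷ xs) = ∑-zero xs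

  ∑-+ : ∀ xs (f g : ℕ → ℕ) → ∑[ x ∈ xs ] (f x + g x) ≡ ∑ xs f + ∑ xs g
  ∑-+ []       f g = refl
  ∑-+ (x ∷ xs) f g =
    trans (cong (f x + g x +_) (∑-+ xs f g)) (interchange (f x) (g x) (∑ xs f) (∑ xs g))

  *-∑ : ∀ c xs (f : ℕ → ℕ) → c * ∑ xs f ≡ ∑[ x ∈ xs ] c * f x
  *-∑ c []       f = *-zeroʳ c
  *-∑ c (x ∷ xs) f = trans (*-distribˡ-+ c (f x) _) (cong (c * f x +_) (*-∑ c xs f))

  ∑-* : ∀ c xs (f : ℕ → ℕ) → ∑ xs f * c ≡ ∑[ x ∈ xs ] f x * c
  ∑-* c xs f = trans (*-comm (∑ xs f) c) (trans (*-∑ c xs f) (∑-cong xs λ {x} _ → *-comm c (f x)))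

  ∑-comm : ∀ xs ys (f : ℕ → ℕ → ℕ) → ∑[ x ∈ xs ] ∑[ y ∈ ys ] f x y ≡ ∑[ y ∈ ys ] ∑[ x ∈ xs ] f x y
  ∑-comm []       ys f = sym (∑-zero ys)
  ∑-comm (x ∷ xs) ys f = trans (cong (∑ ys (f x) +_) (∑-comm xs ys f)) (sym (∑-+ ys (f x) λ y → ∑[ x ∈ xs ] f x y))

  ∑-mono-≤ : ∀ xs {f g : ℕ → ℕ} → (∀ {x} → x ∈ xs → f x ≤ g x) → ∑ xs f ≤ ∑ xs g
  ∑-mono-≤ []       f≤g = z≤n
  ∑-mono-≤ (x ∷ xs) f≤g = +-mono-≤ (f≤g (here refl)) (∑-mono-≤ xs (f≤g ∘ there))

  ∈⇒≤∑ : ∀ {x xs} (f : ℕ → ℕ) → x ∈ xs → f x ≤ ∑ xs f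
  ∈⇒≤∑ f (here refl)  = m≤m+n _ _
  ∈⇒≤∑ f (there x∈xs) = ≤-trans (∈⇒≤∑ f x∈xs) (m≤n+m _ _)

  ∈-[1⋯]⁻ : ∀ {k n} → k ∈ [1⋯ n ] → 0 < k × k ≤ n
  ∈-[1⋯]⁻ k∈ with ∈-applyDownFrom⁻ suc k∈
  ... | i , i<n , refl = s≤s z≤n , i<n

  ∈-[1⋯]⁺ : ∀ {k n} → 0 < k → k ≤ n → k ∈ [1⋯ n ]
  ∈-[1⋯]⁺ {suc _} _ k≤n = ∈-applyDownFrom⁺ suc k≤n

  pairSum-+ : ∀ (f g : ℕ → ℕ → ℕ) N → pairSum (λ k n → f k n + g k n) N ≡ pairSum f N + pairSum g N
  pairSum-+ f g N = trans (∑-cong [1⋯ N ] λ {n} _ → ∑-+ [1⋯ n ] (λ k → f k n) (λ k → g k n))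
                          (∑-+ [1⋯ N ] _ _)

  pairSum-mono-≤ : ∀ {f g} N → (∀ {k n} → 0 < k → k ≤ n → n ≤ N → f k n ≤ g k n) →
                   pairSum f N ≤ pairSum g N
  pairSum-mono-≤ N f≤g = ∑-mono-≤ [1⋯ N ] λ {n} n∈ → ∑-mono-≤ [1⋯ n ] λ k∈ →
    f≤g (proj₁ (∈-[1⋯]⁻ k∈)) (proj₂ (∈-[1⋯]⁻ k∈)) (proj₂ (∈-[1⋯]⁻ n∈))

  pairSum-∑ : ∀ xs (F : ℕ → ℕ → ℕ → ℕ) N → pairSum (λ k n → ∑[ d ∈ xs ] F d k n) N ≡ ∑[ d ∈ xs ] pairSum (F d) N
  pairSum-∑ xs F N = trans (∑-cong [1⋯ N ] λ {n} _ → ∑-comm [1⋯ n ] xs _) (∑-comm [1⋯ N ] xs _)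

  coprimeCount≡∑ : ∀ n j → coprimeCount n j ≡ ∑[ k ∈ [1⋯ j ] ] ⟦ gcd k n ≟ 1 ⟧
  coprimeCount≡∑ n zero    = refl
  coprimeCount≡∑ n (suc j) = cong (⟦ gcd (suc j) n ≟ 1 ⟧ +_) (coprimeCount≡∑ n j)

  sumφ≡pairSum : ∀ N → sumφ N ≡ pairSum (λ k n → ⟦ gcd k n ≟ 1 ⟧) N
  sumφ≡pairSum zero    = refl
  sumφ≡pairSum (suc N) = cong₂ _+_ (coprimeCount≡∑ (suc N) (suc N)) (sumφ≡pairSum N)

  -- Pairs with a common divisor

  multiples : ℕ → ℕ → ℕ
  multiples d N = ∑[ k ∈ [1⋯ N ] ] ⟦ d ∣? k ⟧

  pairsDivisibleBy : ℕ → ℕ → ℕ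
  pairsDivisibleBy d = pairSum (λ k n → ⟦ d ∣? k ⟧ * ⟦ d ∣? n ⟧)

  d*multiples≤N : ∀ d N → d * multiples d N ≤ N
  d*multiples≤N d zero = ≤-reflexive (*-zeroʳ d)
  d*multiples≤N d (suc N) with d ∣? suc N | d*multiples≤N d N
  ... | no _               | dt≤N = m≤n⇒m≤1+n dt≤N
  ... | yes (divides q eq) | dt≤N = begin
    d * suc t ≤⟨ *-monoʳ-≤ d t<q ⟩
    d * q     ≡⟨ trans (*-comm d q) (sym eq) ⟩
    suc N     ∎
    where
    open ≤-Reasoning
    t = multiples d N
    t<q : t < q
    t<q = *-cancelˡ-< d t q (<-≤-trans (s≤s dt≤N) (≤-reflexive (trans eq (*-comm q d))))

  N<d*[1+multiples] : ∀ d N .{{_ : NonZero d}} → N < d * suc (multiples d N)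
  N<d*[1+multiples] d zero = ≤-trans (>-nonZero⁻¹ d) (m≤m*n d 1)
  N<d*[1+multiples] d (suc N) with d ∣? suc N | N<d*[1+multiples] d N
  ... | yes _  | N<dt = ≤-<-trans N<dt (*-monoʳ-< d (n<1+n _))
  ... | no d∤ | N<dt = ≤∧≢⇒< N<dt λ eq → d∤ (divides (suc t) (trans eq (*-comm d (suc t))))
    where t = multiples d N

  2*pairsDivisibleBy≡ : ∀ d N → 2 * pairsDivisibleBy d N ≡ multiples d N * suc (multiples d N)
  2*pairsDivisibleBy≡ d zero    = refl
  2*pairsDivisibleBy≡ d (suc N) = begin
    2 * ((∑[ k ∈ [1⋯ suc N ] ] ⟦ d ∣? k ⟧ * e) + P) ≡⟨ cong (λ s → 2 * (s + P)) (∑-* e [1⋯ suc N ] λ k → ⟦ d ∣? k ⟧) ⟨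
    2 * ((e + t) * e + P)                           ≡⟨ *-distribˡ-+ 2 ((e + t) * e) P ⟩
    2 * ((e + t) * e) + 2 * P                       ≡⟨ cong (2 * ((e + t) * e) +_) (2*pairsDivisibleBy≡ d N) ⟩
    2 * ((e + t) * e) + t * suc t                   ≡⟨ step (d ∣? suc N) ⟩
    (e + t) * suc (e + t)                           ∎
    where
    open ≡-Reasoning
    e = ⟦ d ∣? suc N ⟧
    t = multiples d N
    P = pairsDivisibleBy d N
    step : ∀ {A} (a? : Dec A) → 2 * ((⟦ a? ⟧ + t) * ⟦ a? ⟧) + t * suc t ≡ (⟦ a? ⟧ + t) * suc (⟦ a? ⟧ + t)
    step (yes _) = lemma t
      where
      lemma : ∀ t → 2 * ((1 + t) * 1) + t * suc t ≡ (1 + t) * suc (1 + t)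
      lemma = solve-∀
    step (no _)  = cong (λ x → 2 * x + t * suc t) (*-zeroʳ t)

  module _ (d N : ℕ) where
    open ≤-Reasoning

    private
      t = multiples d N
      P = pairsDivisibleBy d N

    pairsDivisibleBy-upper : d * d * (2 * P) ≤ N * N + d * N
    pairsDivisibleBy-upper = begin
      d * d * (2 * P)                 ≡⟨ cong (d * d *_) (2*pairsDivisibleBy≡ d N) ⟩
      d * d * (t * suc t)             ≡⟨ expand d t ⟩
      (d * t) * (d * t) + d * (d * t) ≤⟨ +-mono-≤ (*-mono-≤ dt≤N dt≤N) (*-monoʳ-≤ d dt≤N) ⟩
      N * N + d * N                   ∎
      where
      dt≤N = d*multiples≤N d N
      expand : ∀ d t → d * d * (t * suc t) ≡ (d * t) * (d * t) + d * (d * t)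
      expand = solve-∀

    pairsDivisibleBy-lower : .{{_ : NonZero d}} → N * N ≤ d * d * (2 * P) + d * N
    pairsDivisibleBy-lower = begin
      N * N                     ≤⟨ *-monoʳ-≤ N N≤d[t+1] ⟩
      N * (d * suc t)           ≡⟨ expand₁ N d t ⟩
      (d * t) * N + d * N       ≤⟨ +-monoˡ-≤ (d * N) (*-monoʳ-≤ (d * t) N≤d[t+1]) ⟩
      (d * t) * (d * suc t) + d * N ≡⟨ cong (_+ d * N) (expand₂ d t) ⟩
      d * d * (t * suc t) + d * N   ≡⟨ cong (λ x → d * d * x + d * N) (2*pairsDivisibleBy≡ d N) ⟨
      d * d * (2 * P) + d * N       ∎
      where
      N≤d[t+1] = <⇒≤ (N<d*[1+multiples] d N)
      expand₁ : ∀ N d t → N * (d * suc t) ≡ (d * t) * N + d * N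
      expand₁ = solve-∀
      expand₂ : ∀ d t → (d * t) * (d * suc t) ≡ d * d * (t * suc t)
      expand₂ = solve-∀

    d²*pairsDivisibleBy≤N² : d * d * P ≤ N * N
    d²*pairsDivisibleBy≤N² = *-cancelˡ-≤ 2 (begin
      2 * (d * d * P)       ≡⟨ x∙yz≈y∙xz 2 (d * d) P ⟩
      d * d * (2 * P)       ≡⟨ cong (d * d *_) (2*pairsDivisibleBy≡ d N) ⟩
      d * d * (t * suc t)   ≤⟨ *-monoʳ-≤ (d * d) (t[t+1]≤2t² t) ⟩
      d * d * (2 * (t * t)) ≡⟨ expand d t ⟩
      2 * ((d * t) * (d * t)) ≤⟨ *-monoʳ-≤ 2 (*-mono-≤ (d*multiples≤N d N) (d*multiples≤N d N)) ⟩
      2 * (N * N)           ∎)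
      where
      open import Algebra.Properties.CommutativeSemigroup *-commutativeSemigroup using (x∙yz≈y∙xz)
      t[t+1]≤2t² : ∀ t → t * suc t ≤ 2 * (t * t)
      t[t+1]≤2t² zero    = z≤n
      t[t+1]≤2t² t@(suc _) = begin
        t * suc t     ≡⟨ *-suc t t ⟩
        t + t * t     ≤⟨ +-monoˡ-≤ (t * t) (m≤m*n t t) ⟩
        t * t + t * t ≡⟨ cong (t * t +_) (+-identityʳ (t * t)) ⟨
        2 * (t * t)   ∎
      expand : ∀ d t → d * d * (2 * (t * t)) ≡ 2 * ((d * t) * (d * t))
      expand = solve-∀

  module _ (R : ℕ) (w : ℕ → ℕ) (xs : List ℕ) (N : ℕ) where
    open ≤-Reasoning

    private
      P : ℕ → ℕ
      P d = pairsDivisibleBy d N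
      regroup : ∀ a b → 2 * a * b ≡ a * (2 * b)
      regroup = solve-∀
      expand : ∀ w d X Y → w * (d * d) * X + w * d * Y ≡ w * (d * d * X + d * Y)
      expand = solve-∀

    ∑pairsDivisibleBy-upper : All (λ d → R ≤ w d * (d * d)) xs →
      2 * R * (∑[ d ∈ xs ] P d) ≤ ∑ xs w * (N * N) + (∑[ d ∈ xs ] w d * d) * N
    ∑pairsDivisibleBy-upper R≤wd² = begin
      2 * R * (∑[ d ∈ xs ] P d)                        ≡⟨ *-∑ (2 * R) xs P ⟩
      ∑[ d ∈ xs ] 2 * R * P d                          ≤⟨ ∑-mono-≤ xs (λ d∈ → termwise (lookup R≤wd² d∈)) ⟩
      ∑[ d ∈ xs ] (w d * (N * N) + w d * d * N)        ≡⟨ ∑-+ xs _ _ ⟩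
      (∑[ d ∈ xs ] w d * (N * N)) + (∑[ d ∈ xs ] w d * d * N)
        ≡⟨ cong₂ _+_ (∑-* (N * N) xs w) (∑-* N xs λ d → w d * d) ⟨
      ∑ xs w * (N * N) + (∑[ d ∈ xs ] w d * d) * N     ∎
      where
      termwise : ∀ {d} → R ≤ w d * (d * d) → 2 * R * P d ≤ w d * (N * N) + w d * d * N
      termwise {d} R≤ = begin
        2 * R * P d                        ≡⟨ regroup R (P d) ⟩
        R * (2 * P d)                      ≤⟨ *-monoˡ-≤ (2 * P d) R≤ ⟩
        w d * (d * d) * (2 * P d)          ≡⟨ *-assoc (w d) (d * d) (2 * P d) ⟩
        w d * (d * d * (2 * P d))          ≤⟨ *-monoʳ-≤ (w d) (pairsDivisibleBy-upper d N) ⟩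
        w d * (N * N + d * N)              ≡⟨ *-distribˡ-+ (w d) (N * N) (d * N) ⟩
        w d * (N * N) + w d * (d * N)      ≡⟨ cong (w d * (N * N) +_) (*-assoc (w d) d N) ⟨
        w d * (N * N) + w d * d * N        ∎

    ∑pairsDivisibleBy-lower : All (λ d → 0 < d × w d * (d * d) ≤ R) xs →
      ∑ xs w * (N * N) ≤ 2 * R * (∑[ d ∈ xs ] P d) + (∑[ d ∈ xs ] w d * d) * N
    ∑pairsDivisibleBy-lower wd²≤R = begin
      ∑ xs w * (N * N)                                 ≡⟨ ∑-* (N * N) xs w ⟩
      ∑[ d ∈ xs ] w d * (N * N)                        ≤⟨ ∑-mono-≤ xs (λ d∈ → termwise (lookup wd²≤R d∈)) ⟩
      ∑[ d ∈ xs ] (2 * R * P d + w d * d * N)          ≡⟨ ∑-+ xs _ _ ⟩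
      (∑[ d ∈ xs ] 2 * R * P d) + (∑[ d ∈ xs ] w d * d * N)
        ≡⟨ cong₂ _+_ (*-∑ (2 * R) xs P) (∑-* N xs λ d → w d * d) ⟨
      2 * R * (∑[ d ∈ xs ] P d) + (∑[ d ∈ xs ] w d * d) * N ∎
      where
      termwise : ∀ {d} → 0 < d × w d * (d * d) ≤ R → w d * (N * N) ≤ 2 * R * P d + w d * d * N
      termwise {d} (0<d , wd²≤R) = begin
        w d * (N * N)                            ≤⟨ *-monoʳ-≤ (w d) (pairsDivisibleBy-lower d N {{>-nonZero 0<d}}) ⟩
        w d * (d * d * (2 * P d) + d * N)        ≡⟨ expand (w d) d (2 * P d) N ⟨
        w d * (d * d) * (2 * P d) + w d * d * N  ≤⟨ +-monoˡ-≤ (w d * d * N) (*-monoˡ-≤ (2 * P d) wd²≤R) ⟩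
        R * (2 * P d) + w d * d * N              ≡⟨ cong (_+ w d * d * N) (regroup R (P d)) ⟨
        2 * R * P d + w d * d * N                ∎

  -- Sieving by 2, 3, 5 and 7

  ⟦∣⟧*⟦∣⟧ : ∀ d m n → ⟦ d ∣? m ⟧ * ⟦ d ∣? n ⟧ ≡ ⟦ d ∣? gcd m n ⟧
  ⟦∣⟧*⟦∣⟧ d m n = ⟦⟧-* (d ∣? m) (d ∣? n) (d ∣? gcd m n)
    (λ d∣g → ∣-trans d∣g (gcd[m,n]∣m m n) , ∣-trans d∣g (gcd[m,n]∣n m n)) gcd-greatest

  1≤∑⟦∣⟧*⟦∣⟧ : ∀ {k n xs} → gcd k n ∈ xs → 1 ≤ ∑[ d ∈ xs ] ⟦ d ∣? k ⟧ * ⟦ d ∣? n ⟧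
  1≤∑⟦∣⟧*⟦∣⟧ {k} {n} {xs} g∈ = begin
    1                                     ≡⟨ cong₂ _*_ (⟦⟧-yes (g ∣? k) (gcd[m,n]∣m k n)) (⟦⟧-yes (g ∣? n) (gcd[m,n]∣n k n)) ⟨
    ⟦ g ∣? k ⟧ * ⟦ g ∣? n ⟧                ≤⟨ ∈⇒≤∑ (λ d → ⟦ d ∣? k ⟧ * ⟦ d ∣? n ⟧) g∈ ⟩
    ∑[ d ∈ xs ] ⟦ d ∣? k ⟧ * ⟦ d ∣? n ⟧     ∎
    where
    open ≤-Reasoning
    g = gcd k n

  -- The divisors of 210 = 2 ⋅ 3 ⋅ 5 ⋅ 7 with Möbius value +1, resp. -1.
  μ⁺210 μ⁻210 : List ℕ
  μ⁺210 = 1 ∷ 6 ∷ 10 ∷ 14 ∷ 15 ∷ 21 ∷ 35 ∷ 210 ∷ []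
  μ⁻210 = 2 ∷ 3 ∷ 5 ∷ 7 ∷ 30 ∷ 42 ∷ 70 ∷ 105 ∷ []

  ∑μ210⟦∣⟧ : ∀ h → h ∣ 210 → ∑[ d ∈ μ⁺210 ] ⟦ d ∣? h ⟧ ≡ (∑[ d ∈ μ⁻210 ] ⟦ d ∣? h ⟧) + ⟦ h ≟ 1 ⟧
  ∑μ210⟦∣⟧ h h∣210 = lookup checked (∈-downFrom⁺ (s≤s (∣⇒≤ h∣210))) h∣210
    where
    checked : All (λ h → h ∣ 210 → ∑[ d ∈ μ⁺210 ] ⟦ d ∣? h ⟧ ≡ (∑[ d ∈ μ⁻210 ] ⟦ d ∣? h ⟧) + ⟦ h ≟ 1 ⟧) (downFrom 211)
    checked = toWitness {a? = all? (λ h → h ∣? 210 →-dec _ ≟ _) (downFrom 211)} _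

  module _ (k n : ℕ) where
    private
      g = gcd k n
      h = gcd g 210
      S : List ℕ → ℕ
      S xs = ∑[ d ∈ xs ] ⟦ d ∣? k ⟧ * ⟦ d ∣? n ⟧

    ∑μ210⟦∣⟧*⟦∣⟧ : S μ⁺210 ≡ S μ⁻210 + ⟦ h ≟ 1 ⟧
    ∑μ210⟦∣⟧*⟦∣⟧ = begin
      S μ⁺210                            ≡⟨ ∑-cong μ⁺210 (λ d∈ → via-h (lookup μ⁺210∣210 d∈)) ⟩
      ∑[ d ∈ μ⁺210 ] ⟦ d ∣? h ⟧            ≡⟨ ∑μ210⟦∣⟧ h (gcd[m,n]∣n g 210) ⟩
      (∑[ d ∈ μ⁻210 ] ⟦ d ∣? h ⟧) + ⟦ h ≟ 1 ⟧ ≡⟨ cong (_+ ⟦ h ≟ 1 ⟧) (∑-cong μ⁻210 (λ d∈ → via-h (lookup μ⁻210∣210 d∈))) ⟨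
      S μ⁻210 + ⟦ h ≟ 1 ⟧                 ∎
      where
      open ≡-Reasoning
      μ⁺210∣210 : All (_∣ 210) μ⁺210
      μ⁺210∣210 = toWitness {a? = all? (_∣? 210) μ⁺210} _
      μ⁻210∣210 : All (_∣ 210) μ⁻210
      μ⁻210∣210 = toWitness {a? = all? (_∣? 210) μ⁻210} _
      via-h : ∀ {d} → d ∣ 210 → ⟦ d ∣? k ⟧ * ⟦ d ∣? n ⟧ ≡ ⟦ d ∣? h ⟧
      via-h {d} d∣210 = begin
        ⟦ d ∣? k ⟧ * ⟦ d ∣? n ⟧  ≡⟨ ⟦∣⟧*⟦∣⟧ d k n ⟩
        ⟦ d ∣? g ⟧              ≡⟨ *-identityʳ _ ⟨
        ⟦ d ∣? g ⟧ * 1          ≡⟨ cong (⟦ d ∣? g ⟧ *_) (⟦⟧-yes (d ∣? 210) d∣210) ⟨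
        ⟦ d ∣? g ⟧ * ⟦ d ∣? 210 ⟧ ≡⟨ ⟦∣⟧*⟦∣⟧ d g 210 ⟩
        ⟦ d ∣? h ⟧              ∎

    ⟦coprime⟧+∑μ⁻≤∑μ⁺ : ⟦ g ≟ 1 ⟧ + S μ⁻210 ≤ S μ⁺210
    ⟦coprime⟧+∑μ⁻≤∑μ⁺ = begin
      ⟦ g ≟ 1 ⟧ + S μ⁻210 ≤⟨ +-monoˡ-≤ (S μ⁻210) (⟦⟧-mono-≤ (g ≟ 1) (h ≟ 1) (cong (λ g → gcd g 210))) ⟩
      ⟦ h ≟ 1 ⟧ + S μ⁻210 ≡⟨ +-comm ⟦ h ≟ 1 ⟧ (S μ⁻210) ⟩
      S μ⁻210 + ⟦ h ≟ 1 ⟧ ≡⟨ ∑μ210⟦∣⟧*⟦∣⟧ ⟨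
      S μ⁺210             ∎
      where open ≤-Reasoning

  coprimeTo210Upto : ℕ → List ℕ
  coprimeTo210Upto D = filter (λ q → 1 <? q ×-dec gcd q 210 ≟ 1) [1⋯ D ]

  above : ℕ → ℕ → List ℕ
  above D M = filter (D <?_) [1⋯ M ]

  module _ (D : ℕ) {M k n : ℕ} (0<k : 0 < k) (k≤n : k ≤ n) (n≤M : n ≤ M) where
    private
      g = gcd k n
      S : List ℕ → ℕ
      S xs = ∑[ d ∈ xs ] ⟦ d ∣? k ⟧ * ⟦ d ∣? n ⟧
      0<g : 0 < g
      0<g = n≢0⇒n>0 (gcd[m,n]≢0 k n (inj₁ (n>0⇒n≢0 0<k)))
      g≤M : g ≤ M
      g≤M = ≤-trans (gcd[m,n]≤n k n {{>-nonZero (≤-trans 0<k k≤n)}}) n≤M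

    ⟦coprime210⟧≤ : ⟦ gcd g 210 ≟ 1 ⟧ ≤ ⟦ g ≟ 1 ⟧ + (S (coprimeTo210Upto D) + S (above D M))
    ⟦coprime210⟧≤ = cover (g ≟ 1) (gcd g 210 ≟ 1)
      where
      cover : (g? : Dec (g ≡ 1)) (h? : Dec (gcd g 210 ≡ 1)) →
              ⟦ h? ⟧ ≤ ⟦ g? ⟧ + (S (coprimeTo210Upto D) + S (above D M))
      cover (yes _)  h?      = ≤-trans (⟦⟧-≤1 h?) (m≤m+n 1 _)
      cover (no _)   (no _)  = z≤n
      cover (no g≢1) (yes h≡1) with g ≤? D
      ... | yes g≤D = ≤-trans (1≤∑⟦∣⟧*⟦∣⟧ g∈) (m≤m+n _ _)
        where g∈ = ∈-filter⁺ _ (∈-[1⋯]⁺ 0<g g≤D) (≤∧≢⇒< 0<g (g≢1 ∘ sym) , h≡1)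
      ... | no g≰D  = ≤-trans (1≤∑⟦∣⟧*⟦∣⟧ g∈) (m≤n+m _ _)
        where g∈ = ∈-filter⁺ _ (∈-[1⋯]⁺ 0<g g≤M) (≰⇒> g≰D)

  above-≤ : ∀ {D M} → M ≤ D → above D M ≡ []
  above-≤ {D} M≤D = filter-none (D <?_) (All.tabulate λ g∈ → ≤⇒≯ (≤-trans (proj₂ (∈-[1⋯]⁻ g∈)) M≤D))

  ∑above-suc : ∀ D G (f : ℕ → ℕ) → D ≤ G → ∑[ g ∈ above D (suc G) ] f g ≡ f (suc G) + (∑[ g ∈ above D G ] f g)
  ∑above-suc D G f D≤G = cong (λ xs → ∑ xs f) (filter-accept (D <?_) (s≤s D≤G))

  module _ (D : ℕ) .{{_ : NonZero D}} where

    private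
      S : ℕ → ℕ → ℕ
      S G N = ∑[ g ∈ above D G ] pairsDivisibleBy g N

    -- Σ_{D<g≤G} A_g(N) ≤ N²/D − N²/G, since A_g(N) ≤ N²/g² ≤ N²/(g − 1) − N²/g.
    ∑above-telescope : ∀ u N → D * (D + u) * S (D + u) N ≤ u * (N * N)
    ∑above-telescope zero N rewrite +-identityʳ D | above-≤ {D} ≤-refl = ≤-reflexive (*-zeroʳ (D * D))
    ∑above-telescope (suc u) N rewrite +-suc D u = *-cancelˡ-≤ G {{G≢0}} (begin
      G * (D * suc G * S (suc G) N)                    ≡⟨ cong (λ x → G * (D * suc G * x)) (∑above-suc D G (λ g → pairsDivisibleBy g N) (m≤m+n D u)) ⟩
      G * (D * suc G * (p + S G N))                    ≡⟨ expand D G p (S G N) ⟩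
      D * suc G * G * p + suc G * (D * G * S G N)      ≤⟨ +-mono-≤ (*-monoˡ-≤ p (*-monoʳ-≤ (D * suc G) (n≤1+n G)))
                                                                   (*-monoʳ-≤ (suc G) (∑above-telescope u N)) ⟩
      D * suc G * suc G * p + suc G * (u * (N * N))    ≡⟨ cong (_+ suc G * (u * (N * N))) (reassoc D (suc G) p) ⟩
      D * (suc G * suc G * p) + suc G * (u * (N * N))  ≤⟨ +-monoˡ-≤ _ (*-monoʳ-≤ D (d²*pairsDivisibleBy≤N² (suc G) N)) ⟩
      D * (N * N) + suc G * (u * (N * N))              ≡⟨ collect D u (N * N) ⟩
      G * (suc u * (N * N))                            ∎)
      where
      open ≤-Reasoning
      G = D + u
      p = pairsDivisibleBy (suc G) N
      G≢0 : NonZero G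
      G≢0 = >-nonZero (≤-trans (>-nonZero⁻¹ D) (m≤m+n D u))
      expand : ∀ D G p t → G * (D * suc G * (p + t)) ≡ D * suc G * G * p + suc G * (D * G * t)
      expand = solve-∀
      reassoc : ∀ D s p → D * s * s * p ≡ D * (s * s * p)
      reassoc = solve-∀
      collect : ∀ D u M → D * M + suc (D + u) * (u * M) ≡ (D + u) * (suc u * M)
      collect = solve-∀

    ∑above-bound : ∀ M → D * S M M ≤ M * M
    ∑above-bound M with D ≤? M
    ... | no  D≰M rewrite above-≤ (<⇒≤ (≰⇒> D≰M)) = ≤-trans (≤-reflexive (*-zeroʳ D)) z≤n
    ... | yes D≤M = subst (λ M → D * S M M ≤ M * M) (m+[n∸m]≡n D≤M) (bound (M ∸ D))
      where
      bound : ∀ u → D * S (D + u) (D + u) ≤ (D + u) * (D + u)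
      bound u = *-cancelˡ-≤ G {{G≢0}} (begin
        G * (D * S G G)     ≡⟨ x∙yz≈y∙xz G D (S G G) ⟩
        D * (G * S G G)     ≡⟨ *-assoc D G (S G G) ⟨
        D * G * S G G       ≤⟨ ∑above-telescope u G ⟩
        u * (G * G)         ≤⟨ *-monoˡ-≤ (G * G) (m≤n+m u D) ⟩
        G * (G * G)         ∎)
        where
        open ≤-Reasoning
        open import Algebra.Properties.CommutativeSemigroup *-commutativeSemigroup using (x∙yz≈y∙xz)
        G = D + u
        G≢0 : NonZero G
        G≢0 = >-nonZero (≤-trans (>-nonZero⁻¹ D) (m≤m+n D u))

  module _ where
    open ≤-Reasoning

    private
      P : List ℕ → ℕ → ℕ
      P xs N = ∑[ d ∈ xs ] pairsDivisibleBy d N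
      F : ℕ → ℕ → ℕ → ℕ
      F d k n = ⟦ d ∣? k ⟧ * ⟦ d ∣? n ⟧
      S : List ℕ → ℕ → ℕ → ℕ
      S xs k n = ∑[ d ∈ xs ] F d k n
      coprime : ℕ → ℕ → ℕ
      coprime k n = ⟦ gcd k n ≟ 1 ⟧

    sumφ+∑μ⁻≤∑μ⁺ : ∀ N → sumφ N + P μ⁻210 N ≤ P μ⁺210 N
    sumφ+∑μ⁻≤∑μ⁺ N = begin
      sumφ N + P μ⁻210 N                        ≡⟨ cong₂ _+_ (sumφ≡pairSum N) (sym (pairSum-∑ μ⁻210 F N)) ⟩
      pairSum coprime N + pairSum (S μ⁻210) N   ≡⟨ pairSum-+ coprime (S μ⁻210) N ⟨
      pairSum (λ k n → coprime k n + S μ⁻210 k n) N ≤⟨ pairSum-mono-≤ N (λ {k} {n} _ _ _ → ⟦coprime⟧+∑μ⁻≤∑μ⁺ k n) ⟩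
      pairSum (S μ⁺210) N                       ≡⟨ pairSum-∑ μ⁺210 F N ⟩
      P μ⁺210 N                                 ∎

    ∑μ⁺≤sumφ+∑μ⁻+∑coprime+∑above : ∀ D M → P μ⁺210 M ≤ (sumφ M + P μ⁻210 M) + (P (coprimeTo210Upto D) M + P (above D M) M)
    ∑μ⁺≤sumφ+∑μ⁻+∑coprime+∑above D M = begin
      P μ⁺210 M                          ≡⟨ pairSum-∑ μ⁺210 F M ⟨
      pairSum (S μ⁺210) M                ≤⟨ pairSum-mono-≤ M pairwise ⟩
      pairSum (λ k n → (coprime k n + S μ⁻210 k n) + (S Q k n + S A k n)) M
        ≡⟨ pairSum-+ (λ k n → coprime k n + S μ⁻210 k n) (λ k n → S Q k n + S A k n) M ⟩
      pairSum (λ k n → coprime k n + S μ⁻210 k n) M + pairSum (λ k n → S Q k n + S A k n) M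
        ≡⟨ cong₂ _+_ (pairSum-+ coprime (S μ⁻210) M) (pairSum-+ (S Q) (S A) M) ⟩
      (pairSum coprime M + pairSum (S μ⁻210) M) + (pairSum (S Q) M + pairSum (S A) M)
        ≡⟨ cong₂ _+_ (cong₂ _+_ (sym (sumφ≡pairSum M)) (pairSum-∑ μ⁻210 F M)) (cong₂ _+_ (pairSum-∑ Q F M) (pairSum-∑ A F M)) ⟩
      (sumφ M + P μ⁻210 M) + (P Q M + P A M) ∎
      where
      Q = coprimeTo210Upto D
      A = above D M
      pairwise : ∀ {k n} → 0 < k → k ≤ n → n ≤ M →
                 S μ⁺210 k n ≤ (coprime k n + S μ⁻210 k n) + (S Q k n + S A k n)
      pairwise {k} {n} 0<k k≤n n≤M = begin
        S μ⁺210 k n                                       ≡⟨ ∑μ210⟦∣⟧*⟦∣⟧ k n ⟩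
        S μ⁻210 k n + ⟦ gcd (gcd k n) 210 ≟ 1 ⟧            ≤⟨ +-monoʳ-≤ (S μ⁻210 k n) (⟦coprime210⟧≤ D 0<k k≤n n≤M) ⟩
        S μ⁻210 k n + (coprime k n + (S Q k n + S A k n))  ≡⟨ x∙yz≈yx∙z (S μ⁻210 k n) (coprime k n) _ ⟩
        (coprime k n + S μ⁻210 k n) + (S Q k n + S A k n)  ∎

  -- Quadratic bounds for sumφ

  -- Opaque, so that the type checker never unfolds a product of a 13-digit constant with an open
  -- term; the numerical facts about these constants are proved in blocks that unfold them.
  opaque
    R : ℕ
    R = 1000000000000

    weight : ℕ → ℕ
    weight zero        = 0
    weight d@(suc _)   = R / (d * d)

    weight*d²≤R : ∀ d → weight d * (d * d) ≤ R
    weight*d²≤R zero        = z≤n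
    weight*d²≤R d@(suc _)   = m/n*n≤m R (d * d)

    R≤[1+weight]*d² : ∀ d → 0 < d → R ≤ suc (weight d) * (d * d)
    R≤[1+weight]*d² d@(suc _) _ = begin
      R                                   ≡⟨ m≡m%n+[m/n]*n R (d * d) ⟩
      R % (d * d) + R / (d * d) * (d * d) ≤⟨ +-monoˡ-≤ _ (<⇒≤ (m%n<n R (d * d))) ⟩
      d * d + R / (d * d) * (d * d)       ∎
      where open ≤-Reasoning

  weight⁺ : ℕ → ℕ
  weight⁺ d = suc (weight d)

  private
    P : List ℕ → ℕ → ℕ
    P xs N = ∑[ d ∈ xs ] pairsDivisibleBy d N

    ∑pairs-upper : ∀ {xs} N → All (0 <_) xs →
      2 * R * P xs N ≤ ∑ xs weight⁺ * (N * N) + (∑[ d ∈ xs ] weight⁺ d * d) * N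
    ∑pairs-upper {xs} N pos = ∑pairsDivisibleBy-upper R weight⁺ xs N (All.map (λ {d} → R≤[1+weight]*d² d) pos)

    ∑pairs-lower : ∀ {xs} N → All (0 <_) xs →
      ∑ xs weight * (N * N) ≤ 2 * R * P xs N + (∑[ d ∈ xs ] weight d * d) * N
    ∑pairs-lower {xs} N pos = ∑pairsDivisibleBy-lower R weight xs N (All.map (λ {d} 0<d → 0<d , weight*d²≤R d) pos)

    μ⁺210-pos : All (0 <_) μ⁺210
    μ⁺210-pos = toWitness {a? = all? (0 <?_) μ⁺210} _
    μ⁻210-pos : All (0 <_) μ⁻210
    μ⁻210-pos = toWitness {a? = all? (0 <?_) μ⁻210} _

  upperCoeff upperLinear : ℕ
  upperCoeff  = ∑ μ⁺210 weight⁺ ∸ ∑ μ⁻210 weight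
  upperLinear = (∑[ d ∈ μ⁺210 ] weight⁺ d * d) + (∑[ d ∈ μ⁻210 ] weight d * d)

  -- The truncated subtraction in upperCoeff does not truncate (and likewise for lowerCoeff below).
  opaque
    unfolding R weight
    upperCoeff-exact : ∑ μ⁺210 weight⁺ ≡ ∑ μ⁻210 weight + upperCoeff
    upperCoeff-exact = refl

  -- upperCoeff / 2R ≈ 0.31347 and upperLinear / 2R ≈ 1.3714.
  sumφ-upper : ∀ N → 2 * R * sumφ N ≤ upperCoeff * (N * N) + upperLinear * N
  sumφ-upper N = +-cancelˡ-≤ (Y * q) _ _ (begin
    Y * q + r * s                  ≤⟨ +-monoˡ-≤ (r * s) (∑pairs-lower N μ⁻210-pos) ⟩
    r * p⁻ + b * N + r * s         ≡⟨ regroup r p⁻ b N s ⟩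
    r * (s + p⁻) + b * N           ≤⟨ +-monoˡ-≤ (b * N) (*-monoʳ-≤ r (sumφ+∑μ⁻≤∑μ⁺ N)) ⟩
    r * p⁺ + b * N                 ≤⟨ +-monoˡ-≤ (b * N) (∑pairs-upper N μ⁺210-pos) ⟩
    X * q + a * N + b * N          ≡⟨ cong (λ X → X * q + a * N + b * N) upperCoeff-exact ⟩
    (Y + upperCoeff) * q + a * N + b * N ≡⟨ collect Y upperCoeff q a b N ⟩
    Y * q + (upperCoeff * q + upperLinear * N) ∎)
    where
    open ≤-Reasoning
    r = 2 * R
    s = sumφ N
    q = N * N
    p⁺ = P μ⁺210 N
    p⁻ = P μ⁻210 N
    X = ∑ μ⁺210 weight⁺
    Y = ∑ μ⁻210 weight
    a = ∑[ d ∈ μ⁺210 ] weight⁺ d * d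
    b = ∑[ d ∈ μ⁻210 ] weight d * d
    regroup : ∀ r p b N s → r * p + b * N + r * s ≡ r * (s + p) + b * N
    regroup = solve-∀
    collect : ∀ Y Γ q a b N → (Y + Γ) * q + a * N + b * N ≡ Y * q + (Γ * q + (a + b) * N)
    collect = solve-∀

  tailCoeff lowerCoeff lowerLinear : ℕ
  tailCoeff   = 2 * R / 400
  lowerCoeff  = ∑ μ⁺210 weight ∸ (∑ μ⁻210 weight⁺ + ∑ (coprimeTo210Upto 400) weight⁺ + tailCoeff)
  lowerLinear = (∑[ d ∈ μ⁺210 ] weight d * d) + (∑[ d ∈ μ⁻210 ] weight⁺ d * d)
              + (∑[ d ∈ coprimeTo210Upto 400 ] weight⁺ d * d)

  opaque
    unfolding R weight
    2R-nonZero : NonZero (2 * R)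
    2R-nonZero = >-nonZero (s≤s z≤n)

    2R≡tailCoeff*400 : 2 * R ≡ tailCoeff * 400
    2R≡tailCoeff*400 = refl

    lowerCoeff-exact : ∑ μ⁺210 weight ≡ (∑ μ⁻210 weight⁺ + ∑ (coprimeTo210Upto 400) weight⁺ + tailCoeff) + lowerCoeff
    lowerCoeff-exact = refl

  -- lowerCoeff / 2R ≈ 0.29562 and lowerLinear / 2R ≈ 1.8466.
  sumφ-lower : ∀ M → lowerCoeff * (M * M) ≤ 2 * R * sumφ M + lowerLinear * M
  sumφ-lower M = +-cancelˡ-≤ (B * q) _ _ (begin
    B * q + lowerCoeff * q                    ≡⟨ *-distribʳ-+ q B lowerCoeff ⟨
    (B + lowerCoeff) * q                      ≡⟨ cong (_* q) lowerCoeff-exact ⟨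
    ∑ μ⁺210 weight * q                        ≤⟨ ∑pairs-lower M μ⁺210-pos ⟩
    r * p⁺ + a * M                            ≤⟨ +-monoˡ-≤ (a * M) (*-monoʳ-≤ r (∑μ⁺≤sumφ+∑μ⁻+∑coprime+∑above 400 M)) ⟩
    r * ((s + p⁻) + (pQ + pT)) + a * M        ≡⟨ expand r s p⁻ pQ pT a M ⟩
    r * s + r * p⁻ + r * pQ + r * pT + a * M  ≤⟨ +-monoˡ-≤ (a * M) (+-mono-≤ (+-mono-≤ (+-monoʳ-≤ (r * s)
                                                   (∑pairs-upper M μ⁻210-pos)) (∑pairs-upper M Q-pos)) tail) ⟩
    r * s + (Yu * q + b * M) + (Qu * q + c * M) + tailCoeff * q + a * M
                                              ≡⟨ collect r s Yu b Qu c tailCoeff q a M ⟩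
    B * q + (r * s + lowerLinear * M)         ∎)
    where
    open ≤-Reasoning
    Q = coprimeTo210Upto 400
    r = 2 * R
    s = sumφ M
    q = M * M
    p⁺ = P μ⁺210 M
    p⁻ = P μ⁻210 M
    pQ = P Q M
    pT = P (above 400 M) M
    Yu = ∑ μ⁻210 weight⁺
    Qu = ∑ Q weight⁺
    B = Yu + Qu + tailCoeff
    a = ∑[ d ∈ μ⁺210 ] weight d * d
    b = ∑[ d ∈ μ⁻210 ] weight⁺ d * d
    c = ∑[ d ∈ Q ] weight⁺ d * d
    Q-pos : All (0 <_) Q
    Q-pos = toWitness {a? = all? (0 <?_) Q} _
    tail : r * pT ≤ tailCoeff * q
    tail = begin
      r * pT                 ≡⟨ cong (_* pT) 2R≡tailCoeff*400 ⟩
      tailCoeff * 400 * pT   ≡⟨ *-assoc tailCoeff 400 pT ⟩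
      tailCoeff * (400 * pT) ≤⟨ *-monoʳ-≤ tailCoeff (∑above-bound 400 M) ⟩
      tailCoeff * q          ∎
    expand : ∀ r s p pQ pT a M → r * ((s + p) + (pQ + pT)) + a * M ≡ r * s + r * p + r * pQ + r * pT + a * M
    expand = solve-∀
    collect : ∀ r s Yu b Qu c t q a M →
              r * s + (Yu * q + b * M) + (Qu * q + c * M) + t * q + a * M ≡ (Yu + Qu + t) * q + (r * s + (a + b + c) * M)
    collect = solve-∀

  -- The ratio bounds for large and small N

  -- If c N = K m + r with r ≤ Z, then α m² ≈ α c² N² / K², which exceeds Γ N² by A N² / K²;
  -- once A N dominates the linear terms the inequality follows.
  quadratic-margin : ∀ {K Z} Γ δ β α c A N m r .{{_ : NonZero K}} →
    α * (c * c) ≡ K * K * Γ + A →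
    K * K * δ + K * β * c + 3 * Z * α * c ≤ A * N →
    c * N ≡ K * m + r → r ≤ Z →
    Γ * (N * N) + δ * N + β * m ≤ α * (m * m)
  quadratic-margin {K} {Z} Γ δ β α c A N m r αc²≡ linear≤ cN≡ r≤Z =
    *-cancelˡ-≤ (K * K) {{m*n≢0 K K}} (+-cancelʳ-≤ (3 * Z * α * x) _ _ (begin
      K * K * (Γ * (N * N) + δ * N + β * m) + 3 * Z * α * x
        ≡⟨ e₁ K Γ δ β m N (3 * Z * α * x) ⟩
      K * K * Γ * (N * N) + K * K * δ * N + K * β * (K * m) + 3 * Z * α * x
        ≤⟨ +-monoˡ-≤ (3 * Z * α * x) (+-monoʳ-≤ _ (*-monoʳ-≤ (K * β) Km≤x)) ⟩
      K * K * Γ * (N * N) + K * K * δ * N + K * β * x + 3 * Z * α * x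
        ≡⟨ e₂ K Z Γ δ β c α N ⟩
      K * K * Γ * (N * N) + (K * K * δ + K * β * c + 3 * Z * α * c) * N
        ≤⟨ +-monoʳ-≤ _ (*-monoˡ-≤ N linear≤) ⟩
      K * K * Γ * (N * N) + A * N * N
        ≡⟨ e₃ K Γ A N ⟩
      (K * K * Γ + A) * (N * N)
        ≡⟨ cong (_* (N * N)) αc²≡ ⟨
      α * (c * c) * (N * N)
        ≡⟨ e₄ α c N ⟩
      α * (x * x)
        ≡⟨ cong (λ y → α * (y * y)) cN≡ ⟩
      α * ((K * m + r) * (K * m + r))
        ≡⟨ e₅ K α m r ⟩
      K * K * (α * (m * m)) + (2 * α * (K * m) * r + α * r * r)
        ≤⟨ +-monoʳ-≤ (K * K * (α * (m * m))) (+-mono-≤ (*-mono-≤ (*-monoʳ-≤ (2 * α) Km≤x) r≤Z) (*-mono-≤ (*-monoʳ-≤ α r≤Z) r≤x)) ⟩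
      K * K * (α * (m * m)) + (2 * α * x * Z + α * Z * x)
        ≡⟨ cong (K * K * (α * (m * m)) +_) (e₆ Z α x) ⟩
      K * K * (α * (m * m)) + 3 * Z * α * x ∎))
    where
    open ≤-Reasoning
    x = c * N
    Km≤x : K * m ≤ x
    Km≤x = subst (K * m ≤_) (sym cN≡) (m≤m+n (K * m) r)
    r≤x : r ≤ x
    r≤x = subst (r ≤_) (sym cN≡) (m≤n+m r (K * m))
    e₁ : ∀ K Γ δ β m N y → K * K * (Γ * (N * N) + δ * N + β * m) + y ≡ K * K * Γ * (N * N) + K * K * δ * N + K * β * (K * m) + y
    e₁ = solve-∀
    e₂ : ∀ K Z Γ δ β c α N → K * K * Γ * (N * N) + K * K * δ * N + K * β * (c * N) + 3 * Z * α * (c * N)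
                           ≡ K * K * Γ * (N * N) + (K * K * δ + K * β * c + 3 * Z * α * c) * N
    e₂ = solve-∀
    e₃ : ∀ K Γ A N → K * K * Γ * (N * N) + A * N * N ≡ (K * K * Γ + A) * (N * N)
    e₃ = solve-∀
    e₄ : ∀ α c N → α * (c * c) * (N * N) ≡ α * ((c * N) * (c * N))
    e₄ = solve-∀
    e₅ : ∀ K α m r → α * ((K * m + r) * (K * m + r)) ≡ K * K * (α * (m * m)) + (2 * α * (K * m) * r + α * r * r)
    e₅ = solve-∀
    e₆ : ∀ Z α x → 2 * α * x * Z + α * Z * x ≡ 3 * Z * α * x
    e₆ = solve-∀

  ratio-from-estimates : ∀ {ρ a s s′ Γ δ α β N m} .{{_ : NonZero ρ}} →
    ρ * s ≤ Γ * (N * N) + δ * N →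
    α * (m * m) ≤ ρ * s′ + β * m →
    a * Γ * (N * N) + a * δ * N + 4 * β * m ≤ 4 * α * (m * m) →
    a * s ≤ 4 * s′
  ratio-from-estimates {ρ} {a} {s} {s′} {Γ} {δ} {α} {β} {N} {m} upper lower margin =
    *-cancelˡ-≤ ρ (+-cancelʳ-≤ (4 * β * m) _ _ (begin
      ρ * (a * s) + 4 * β * m                  ≡⟨ cong (_+ 4 * β * m) (x∙yz≈y∙xz ρ a s) ⟩
      a * (ρ * s) + 4 * β * m                  ≤⟨ +-monoˡ-≤ _ (*-monoʳ-≤ a upper) ⟩
      a * (Γ * (N * N) + δ * N) + 4 * β * m    ≡⟨ e₁ a Γ δ β N m ⟩
      a * Γ * (N * N) + a * δ * N + 4 * β * m  ≤⟨ margin ⟩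
      4 * α * (m * m)                          ≡⟨ *-assoc 4 α (m * m) ⟩
      4 * (α * (m * m))                        ≤⟨ *-monoʳ-≤ 4 lower ⟩
      4 * (ρ * s′ + β * m)                     ≡⟨ e₂ ρ s′ β m ⟩
      ρ * (4 * s′) + 4 * β * m                 ∎))
    where
    open ≤-Reasoning
    open import Algebra.Properties.CommutativeSemigroup *-commutativeSemigroup using (x∙yz≈y∙xz)
    e₁ : ∀ a Γ δ β N m → a * (Γ * (N * N) + δ * N) + 4 * β * m ≡ a * Γ * (N * N) + a * δ * N + 4 * β * m
    e₁ = solve-∀
    e₂ : ∀ ρ s β m → 4 * (ρ * s + β * m) ≡ ρ * (4 * s) + 4 * β * m
    e₂ = solve-∀

  marginCoeff : ℕ → ℕ → ℕ
  marginCoeff a c = 4 * lowerCoeff * (c * c) ∸ 1000 * 1000 * (a * upperCoeff)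

  sumφ-ratio-large : ∀ a c N₀ →
    4 * lowerCoeff * (c * c) ≡ 1000 * 1000 * (a * upperCoeff) + marginCoeff a c →
    1000 * 1000 * (a * upperLinear) + 1000 * (4 * lowerLinear) * c + 3 * 999 * (4 * lowerCoeff) * c ≤ marginCoeff a c * N₀ →
    ∀ N → N₀ ≤ N → a * sumφ N ≤ 4 * sumφ (c * N / 1000)
  sumφ-ratio-large a c N₀ α≡ linear≤ N N₀≤N =
    ratio-from-estimates {2 * R} {a} {sumφ N} {sumφ m} {upperCoeff} {upperLinear} {lowerCoeff} {lowerLinear} {N} {m} {{2R-nonZero}}
      (sumφ-upper N) (sumφ-lower m)
      (quadratic-margin {1000} {999} (a * upperCoeff) (a * upperLinear) (4 * lowerLinear) (4 * lowerCoeff) c (marginCoeff a c) N m r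
        α≡ (≤-trans linear≤ (*-monoʳ-≤ (marginCoeff a c) N₀≤N)) cN≡1000m+r (≤-pred (m%n<n (c * N) 1000)))
    where
    m = c * N / 1000
    r = c * N % 1000
    cN≡1000m+r : c * N ≡ 1000 * m + r
    cN≡1000m+r = trans (m≡m%n+[m/n]*n (c * N) 1000) (trans (+-comm r (m * 1000)) (cong (_+ r) (*-comm m 1000)))

  at : List ℕ → ℕ → ℕ
  at []       _       = 0
  at (x ∷ _)  zero    = x
  at (_ ∷ xs) (suc i) = at xs i

  at-map-downFrom : ∀ (f : ℕ → ℕ) {i n} → i ≤ n → at (map f (downFrom (suc n))) (n ∸ i) ≡ f i
  at-map-downFrom f {n = zero}  z≤n = refl
  at-map-downFrom f {i} {suc n} i≤1+n with i ≟ suc n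
  ... | yes refl = cong (at (map f (downFrom (suc (suc n))))) (n∸n≡0 (suc n))
  ... | no  i≢1+n = trans (cong (at (map f (downFrom (suc (suc n))))) (+-∸-assoc 1 i≤n)) (at-map-downFrom f i≤n)
    where i≤n = ≤-pred (≤∧≢⇒< i≤1+n i≢1+n)

  -- sumφs n = [sumφ n, …, sumφ 0], built so that each φ k is evaluated only once.
  sumφs : ℕ → List ℕ
  sumφs zero    = 0 ∷ []
  sumφs (suc n) = push (sumφs n)
    where
    push : List ℕ → List ℕ
    push []       = []
    push (s ∷ ss) = φ (suc n) + s ∷ s ∷ ss

  sumφs≡ : ∀ n → sumφs n ≡ map sumφ (downFrom (suc n))
  sumφs≡ zero    = refl
  sumφs≡ (suc n) rewrite sumφs≡ n = refl

  RatioBound : ℕ → ℕ → ℕ → Set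
  RatioBound a c N = a * sumφ N ≤ 4 * sumφ (c * N / 1000) + 8

  c*N/1000≤N : ∀ c N → c ≤ 1000 → c * N / 1000 ≤ N
  c*N/1000≤N c N c≤1000 = begin
    c * N / 1000    ≤⟨ /-monoˡ-≤ 1000 (*-monoˡ-≤ N c≤1000) ⟩
    1000 * N / 1000 ≡⟨ cong (_/ 1000) (*-comm 1000 N) ⟩
    N * 1000 / 1000 ≡⟨ m*n/n≡m N 1000 ⟩
    N               ∎
    where open ≤-Reasoning

  ratioBoundᵇ : List ℕ → ℕ → ℕ → ℕ → ℕ → Bool
  ratioBoundᵇ table n a c N = a * at table (n ∸ N) ≤ᵇ 4 * at table (n ∸ (c * N / 1000)) + 8

  ratioBoundᵇ⇒RatioBound : ∀ {table n a c N} → table ≡ map sumφ (downFrom (suc n)) → c ≤ 1000 → N ≤ n →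
                           T (ratioBoundᵇ table n a c N) → RatioBound a c N
  ratioBoundᵇ⇒RatioBound {a = a} {c} {N} refl c≤1000 N≤n checked =
    subst₂ (λ x y → a * x ≤ 4 * y + 8)
      (at-map-downFrom sumφ N≤n) (at-map-downFrom sumφ (≤-trans (c*N/1000≤N c N c≤1000) N≤n)) (≤ᵇ⇒≤ _ _ checked)

  smallRatioᵇ : List ℕ → ℕ → Bool
  smallRatioᵇ table N = ratioBoundᵇ table 459 1 539 N ∧ ratioBoundᵇ table 459 2 742 N ∧ ratioBoundᵇ table 459 3 917 N

  smallRatiosᵇ : List ℕ → Bool
  smallRatiosᵇ table = all (λ N → smallRatioᵇ table N) (downFrom 460)

  -- Stated for a variable table, so that sumφs 459 is evaluated only once, in small-cases.
  small-cases-from : ∀ table → table ≡ map sumφ (downFrom (suc 459)) → T (smallRatiosᵇ table) →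
    ∀ N → N < 460 → RatioBound 1 539 N × RatioBound 2 742 N × RatioBound 3 917 N
  small-cases-from table table≡ checked N N<460 =
    let b₁ , b₂ , b₃ = T-∧³ checked-at-N in sound {1} {539} b₁ , sound {2} {742} b₂ , sound {3} {917} b₃
    where
    checked-at-N : T (smallRatioᵇ table N)
    checked-at-N = lookup (all⁺ (λ N → smallRatioᵇ table N) (downFrom 460) checked) (∈-downFrom⁺ N<460)
    T-∧³ : ∀ {x y z} → T (x ∧ y ∧ z) → T x × T y × T z
    T-∧³ {x} {y} {z} t = Product.map₂ (Equivalence.to (T-∧ {y} {z})) (Equivalence.to (T-∧ {x}) t)
    sound : ∀ {a c} {c≤1000 : T (c ≤ᵇ 1000)} → T (ratioBoundᵇ table 459 a c N) → RatioBound a c N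
    sound {a} {c} {c≤1000} = ratioBoundᵇ⇒RatioBound {n = 459} {a} table≡ (≤ᵇ⇒≤ c 1000 c≤1000) (≤-pred N<460)

  small-cases : ∀ N → N < 460 → RatioBound 1 539 N × RatioBound 2 742 N × RatioBound 3 917 N
  small-cases = small-cases-from (sumφs 459) (sumφs≡ 459) _


  sumφ-mono-≤ : ∀ {m n} → m ≤ n → sumφ m ≤ sumφ n
  sumφ-mono-≤ {m} {zero}  m≤0 rewrite n≤0⇒n≡0 m≤0 = ≤-refl
  sumφ-mono-≤ {m} {suc n} m≤1+n with m ≟ suc n
  ... | yes refl  = ≤-refl
  ... | no  m≢1+n = ≤-trans (sumφ-mono-≤ (≤-pred (≤∧≢⇒< m≤1+n m≢1+n))) (m≤n+m (sumφ n) (φ (suc n)))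

  sumφ-ratio : ∀ {a c} → (∀ N → N < 460 → RatioBound a c N) →
               (∀ N → 460 ≤ N → a * sumφ N ≤ 4 * sumφ (c * N / 1000)) → ∀ N → RatioBound a c N
  sumφ-ratio small large N with N <? 460
  ... | yes N<460 = small N N<460
  ... | no  N≮460 = ≤-trans (large N (≮⇒≥ N≮460)) (m≤m+n _ 8)

  opaque
    unfolding R weight

    sumφ-ratio₁ : ∀ N → RatioBound 1 539 N
    sumφ-ratio₁ = sumφ-ratio {1} {539} (λ N N<460 → proj₁ (small-cases N N<460))
                             (sumφ-ratio-large 1 539 460 refl (toWitness {a? = _ ≤? _} _))

    sumφ-ratio₂ : ∀ N → RatioBound 2 742 N
    sumφ-ratio₂ = sumφ-ratio {2} {742} (λ N N<460 → proj₁ (proj₂ (small-cases N N<460)))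
                             (sumφ-ratio-large 2 742 460 refl (toWitness {a? = _ ≤? _} _))

    sumφ-ratio₃ : ∀ N → RatioBound 3 917 N
    sumφ-ratio₃ = sumφ-ratio {3} {917} (λ N N<460 → proj₂ (proj₂ (small-cases N N<460)))
                             (sumφ-ratio-large 3 917 460 refl (toWitness {a? = _ ≤? _} _))

module _ where
  open import Data.Nat as ℕ using (ℕ; suc)
  import Data.Nat.Properties as ℕ
  open import Data.Nat.Coprimality using (Coprime)
  open import Data.Nat.DivMod using (m*n/n≡m; /-monoˡ-≤; m/n*n≤m)
  open import Data.Integer as ℤ using (ℤ; +_; -[1+_]; ∣_∣)
  import Data.Integer.Properties as ℤ
  open import Data.Rational using (ℚ; mkℚ; floor; _≤_; *≤*; _*_; _-_; -_; _/_; 0ℚ; 1ℚ; toℚᵘ)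
  open import Data.Rational.Properties
    using (≤-trans; *-monoˡ-≤-nonNeg; normalize-nonNeg; toℚᵘ-mono-≤; toℚᵘ-fromℚᵘ; toℚᵘ-cancel-≤; toℚᵘ-homo-*; toℚᵘ-homo-+; toℚᵘ-homo‿-)
  open import Data.Rational.Unnormalised as ᵘ using (ℚᵘ; mkℚᵘ; _≃_)
  import Data.Rational.Unnormalised.Properties as ᵘ
  open import Relation.Binary.PropositionalEquality

  toℚᵘ-/ : ∀ n d → toℚᵘ (n / suc d) ≃ mkℚᵘ n d
  toℚᵘ-/ n d = toℚᵘ-fromℚᵘ (mkℚᵘ n d)

  a/4*S-2≤T : ∀ a S T → a ℕ.* S ℕ.≤ 4 ℕ.* T ℕ.+ 8 → (+ a / 4) * (+ S / 1) - (+ 2 / 1) ≤ + T / 1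
  a/4*S-2≤T a S T aS≤4T+8 = toℚᵘ-cancel-≤ (ᵘ.≤-respˡ-≃ (ᵘ.≃-sym lhs) (ᵘ.≤-respʳ-≃ (ᵘ.≃-sym (toℚᵘ-/ (+ T) 0)) (ᵘ.*≤* cross)))
    where
    open import Data.Integer.Tactic.RingSolver using (solve-∀)
    lhs : toℚᵘ ((+ a / 4) * (+ S / 1) - (+ 2 / 1)) ≃ mkℚᵘ (+ a) 3 ᵘ.* mkℚᵘ (+ S) 0 ᵘ.- mkℚᵘ (+ 2) 0
    lhs = ᵘ.≃-trans (toℚᵘ-homo-+ ((+ a / 4) * (+ S / 1)) (- (+ 2 / 1)))
            (ᵘ.+-cong (ᵘ.≃-trans (toℚᵘ-homo-* (+ a / 4) (+ S / 1)) (ᵘ.*-cong (toℚᵘ-/ (+ a) 3) (toℚᵘ-/ (+ S) 0)))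
                      (ᵘ.≃-trans (toℚᵘ-homo‿- (+ 2 / 1)) (ᵘ.-‿cong (toℚᵘ-/ (+ 2) 0))))
    cross : ((+ a ℤ.* + S) ℤ.* + 1 ℤ.+ (ℤ.- + 2) ℤ.* + 4) ℤ.* + 1 ℤ.≤ + T ℤ.* + 4
    cross = begin
      ((+ a ℤ.* + S) ℤ.* + 1 ℤ.+ (ℤ.- + 2) ℤ.* + 4) ℤ.* + 1 ≡⟨ e₁ (+ a ℤ.* + S) ⟩
      + a ℤ.* + S ℤ.- + 8                                   ≡⟨ cong (ℤ._- + 8) (ℤ.pos-* a S) ⟨
      + (a ℕ.* S) ℤ.- + 8                                   ≤⟨ ℤ.+-monoˡ-≤ (ℤ.- + 8) (ℤ.+≤+ aS≤4T+8) ⟩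
      + (4 ℕ.* T ℕ.+ 8) ℤ.- + 8                             ≡⟨ cong (ℤ._- + 8) (trans (ℤ.pos-+ (4 ℕ.* T) 8) (cong (ℤ._+ + 8) (ℤ.pos-* 4 T))) ⟩
      + 4 ℤ.* + T ℤ.+ + 8 ℤ.- + 8                           ≡⟨ e₂ (+ T) ⟩
      + T ℤ.* + 4                                           ∎
      where
      open ℤ.≤-Reasoning
      e₁ : ∀ x → (x ℤ.* + 1 ℤ.+ (ℤ.- + 2) ℤ.* + 4) ℤ.* + 1 ≡ x ℤ.- + 8
      e₁ = solve-∀
      e₂ : ∀ t → + 4 ℤ.* t ℤ.+ + 8 ℤ.- + 8 ≡ t ℤ.* + 4
      e₂ = solve-∀

  ∣floor∣≡ : ∀ n d .(c : Coprime n (suc d)) → ∣ floor (mkℚ (+ n) d c) ∣ ≡ n ℕ./ suc d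
  ∣floor∣≡ n d c = cong ∣_∣ (ℤ.*-identityˡ (+ (n ℕ./ suc d)))

  k/1≤⇒k*d≤n : ∀ {k} n d .(c : Coprime ∣ n ∣ (suc d)) → + k / 1 ≤ mkℚ n d c → + (k ℕ.* suc d) ℤ.≤ n
  k/1≤⇒k*d≤n {k} n d c k/1≤n/d with ᵘ.*≤* k*d≤n*1 ← ᵘ.≤-respˡ-≃ (toℚᵘ-/ (+ k) 0) (toℚᵘ-mono-≤ k/1≤n/d) =
    subst₂ ℤ._≤_ (sym (ℤ.pos-* k (suc d))) (ℤ.*-identityʳ n) k*d≤n*1

  ≤⇒≤∣floor∣ : ∀ {k} y → + k / 1 ≤ y → k ℕ.≤ ∣ floor y ∣
  ≤⇒≤∣floor∣ {k} (mkℚ (+ n) d c) k≤y = subst (k ℕ.≤_) (sym (∣floor∣≡ n d c))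
    (subst (ℕ._≤ n ℕ./ suc d) (m*n/n≡m k (suc d)) (/-monoˡ-≤ (suc d) (ℤ.drop‿+≤+ (k/1≤⇒k*d≤n {k} (+ n) d c k≤y))))
  ≤⇒≤∣floor∣ {k} (mkℚ -[1+ n ] d c) k≤y with () ← k/1≤⇒k*d≤n {k} -[1+ n ] d c k≤y

  ∣floor∣≤ : ∀ x → 0ℚ ≤ x → + ∣ floor x ∣ / 1 ≤ x
  ∣floor∣≤ (mkℚ (+ n) d c) _ = subst (λ k → + k / 1 ≤ mkℚ (+ n) d c) (sym (∣floor∣≡ n d c))
    (toℚᵘ-cancel-≤ (ᵘ.≤-respˡ-≃ (ᵘ.≃-sym (toℚᵘ-/ (+ (n ℕ./ suc d)) 0))
      (ᵘ.*≤* (subst₂ ℤ._≤_ (ℤ.pos-* (n ℕ./ suc d) (suc d)) (sym (ℤ.*-identityʳ (+ n))) (ℤ.+≤+ (m/n*n≤m n (suc d)))))))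
  ∣floor∣≤ (mkℚ -[1+ _ ] _ _) (*≤* ())

  ≤∣floor[c/d*x]∣ : ∀ c d x m → 0ℚ ≤ x → m ℕ.* suc d ℕ.≤ c ℕ.* ∣ floor x ∣ → m ℕ.≤ ∣ floor ((+ c / suc d) * x) ∣
  ≤∣floor[c/d*x]∣ c d x m 0≤x md≤cN = ≤⇒≤∣floor∣ ((+ c / suc d) * x)
    (≤-trans m≤c/d*N (*-monoˡ-≤-nonNeg (+ c / suc d) {{normalize-nonNeg c (suc d)}} (∣floor∣≤ x 0≤x)))
    where
    N = ∣ floor x ∣
    m≤c/d*N : + m / 1 ≤ (+ c / suc d) * (+ N / 1)
    m≤c/d*N = toℚᵘ-cancel-≤ (ᵘ.≤-respˡ-≃ (ᵘ.≃-sym (toℚᵘ-/ (+ m) 0))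
      (ᵘ.≤-respʳ-≃ (ᵘ.≃-sym (ᵘ.≃-trans (toℚᵘ-homo-* (+ c / suc d) (+ N / 1)) (ᵘ.*-cong (toℚᵘ-/ (+ c) d) (toℚᵘ-/ (+ N) 0))))
        (ᵘ.*≤* (subst₂ ℤ._≤_ (trans (ℤ.pos-* m (suc d)) (cong (λ e → + m ℤ.* + suc e) (sym (ℕ.*-identityʳ d)))) (trans (ℤ.pos-* c N) (sym (ℤ.*-identityʳ _))) (ℤ.+≤+ md≤cN)))))


  -- For a = 2 the coefficient + 2 / 4 normalises to the + 1 / 2 of the statement.
  K-ratio : ∀ a c x → 1ℚ ≤ x → (∀ N → RatioBound a c N) →
            (+ a / 4) * (+ K x / 1) - (+ 2 / 1) ≤ + K ((+ c / 1000) * x) / 1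
  K-ratio a c x 1≤x bound =
    a/4*S-2≤T a (K x) (K y) (ℕ.≤-trans (bound N) (ℕ.+-monoˡ-≤ 8 (ℕ.*-monoʳ-≤ 4 (sumφ-mono-≤ m≤⌊y⌋))))
    where
    N = ∣ floor x ∣
    y = (+ c / 1000) * x
    m≤⌊y⌋ : c ℕ.* N ℕ./ 1000 ℕ.≤ ∣ floor y ∣
    m≤⌊y⌋ = ≤∣floor[c/d*x]∣ c 999 x (c ℕ.* N ℕ./ 1000) (≤-trans (*≤* (ℤ.+≤+ ℕ.z≤n)) 1≤x) (m/n*n≤m (c ℕ.* N) 1000)

open import Data.Product using (_×_; _,_)
open import Data.Integer using (+_)
open import Data.Rational using (ℚ; _≤_; _*_; _-_; _/_; 1ℚ; 0ℚ)

corollary18 : (x : ℚ) → 1ℚ ≤ x →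
    ((+ 1 / 4) * ((+ K x) / 1) - (+ 2 / 1) ≤ (+ K ((+ 539 / 1000) * x)) / 1)
    × ((+ 1 / 2) * ((+ K x) / 1) - (+ 2 / 1) ≤ (+ K ((+ 742 / 1000) * x)) / 1)
    × ((+ 3 / 4) * ((+ K x) / 1) - (+ 2 / 1) ≤ (+ K ((+ 917 / 1000) * x)) / 1)
corollary18 x 1≤x = K-ratio 1 539 x 1≤x sumφ-ratio₁ , K-ratio 2 742 x 1≤x sumφ-ratio₂ , K-ratio 3 917 x 1≤x sumφ-ratio₃
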